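{- Let $N \in \mathbb{N}$ and $k \ge 1$. Fix an integer $n > \pi_N(k)$ and let $\mathcal{S} = (s_0, \ldots, s_{\pi_N(k)-1})$ where $s_\alpha \in \mathbb{Z}/N\mathbb{Z}$ is the residue of $[q^\alpha]\begin{bmatrix} n+k \\ k \end{bmatrix}_q$ modulo $N$. Then $s_{\pi_N(k)-1}, s_{\pi_N(k)-2}, \ldots, s_{\pi_N(k)-\binom{k+1}{2}+1}$ are all $0$ modulo $N$, and $s_i = (-1)^{k+1} s_{\pi_N(k)-\binom{k+1}{2}-i}$ for all $0 \le i \le \pi_N(k)-\binom{k+1}{2}$.
   Context: The Gaussian polynomial is $\begin{bmatrix} n \\ k \end{bmatrix}_q = \frac{[n]!}{[n-k]!\,[k]!}$ with $[m]! = \prod_{i=1}^{m} \frac{1-q^i}{1-q}$; $[q^\alpha]f$ is the coefficient of $q^\alpha$ in $f$. $p_{\le k}(n)$ denotes the number of partitions of $n$ with at most $k$ parts; $(p_{\le k}(n) \bmod N)_{n\ge0}$ is purely periodic and $\pi_N(k)$ denotes its minimal period. -}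

module Defs where

open import Data.Bool using (Bool; true; false; _∧_; if_then_else_)
open import Data.Nat as ℕ using (ℕ; zero; suc; _∸_; _≡ᵇ_; _≤ᵇ_)
open import Data.Nat.Divisibility using (_∣?_)
open import Data.Integer as ℤ using (ℤ; +_; -_; _*_; _+_; _-_; -1ℤ; 0ℤ; 1ℤ)
open import Data.Integer.Divisibility as ℤD using ()
open import Data.List using (List; []; _∷_; [_]; map; concatMap; upTo; filterᵇ; length)
open import Data.Vec using (Vec; []; _∷_)
open import Data.Product using (_×_)
open import Relation.Nullary using (does)
open import Relation.Binary.PropositionalEquality using (_≡_)

-- A partition of n with at most k parts is identified with a
-- nonincreasing vector (a₁ ≥ … ≥ a_k ≥ 0) of length k summing to n
-- (the parts, padded with zeros).  Every entry is ≤ n, so we enumerate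
-- all vectors of length k with entries in {0..n} and count.

allVecs : (k b : ℕ) → List (Vec ℕ k)
allVecs zero    b = [ [] ]
allVecs (suc k) b = concatMap (λ a → map (a ∷_) (allVecs k b)) (upTo (suc b))

nonincreasing : ∀ {k} → Vec ℕ k → Bool
nonincreasing []               = true
nonincreasing (a ∷ [])         = true
nonincreasing (a ∷ (b ∷ v))    = (b ≤ᵇ a) ∧ nonincreasing (b ∷ v)

vsum : ∀ {k} → Vec ℕ k → ℕ
vsum []      = 0
vsum (a ∷ v) = a ℕ.+ vsum v

pLe : (k n : ℕ) → ℕ
pLe k n = length (filterᵇ (λ v → nonincreasing v ∧ (vsum v ≡ᵇ n)) (allVecs k n))

-- Congruence modulo N in ℤ (N = 0 gives equality, i.e. ℤ/0ℤ = ℤ).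

_≡[mod_]_ : ℤ → ℕ → ℤ → Set
a ≡[mod N ] b = (+ N) ℤD.∣ (a - b)

IsPeriod : (N k P : ℕ) → Set
IsPeriod N k P = (1 ℕ.≤ P) × (∀ n → (+ pLe k (n ℕ.+ P)) ≡[mod N ] (+ pLe k n))

IsMinPeriod : (N k P : ℕ) → Set
IsMinPeriod N k P = IsPeriod N k P × (∀ Q → IsPeriod N k Q → P ℕ.≤ Q)

Series : Set
Series = ℕ → ℤ

sumBelow : (ℕ → ℤ) → ℕ → ℤ
sumBelow f zero    = 0ℤ
sumBelow f (suc m) = sumBelow f m + f m

_⊛_ : Series → Series → Series
(f ⊛ g) α = sumBelow (λ j → f j * g (α ∸ j)) (suc α)

one : Series
one zero    = 1ℤ
one (suc _) = 0ℤ

oneMinusQ : ℕ → Series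
oneMinusQ i α = one α - (if α ≡ᵇ i then 1ℤ else 0ℤ)

-- 1/(1 - q^i) = Σ_m q^{i m}   (used for i ≥ 1)
invOneMinusQ : ℕ → Series
invOneMinusQ i α = if does (i ∣? α) then 1ℤ else 0ℤ

prodTo : (ℕ → Series) → ℕ → Series
prodTo F zero    = one
prodTo F (suc m) = prodTo F m ⊛ F (suc m)

-- Gaussian polynomial [a choose b]_q = [a]! / ([a-b]! [b]!) with
-- [m]! = ∏_{i=1}^m (1-q^i)/(1-q); the (1-q) factors cancel (a = (a-b)+b),
-- giving ∏_{i≤a}(1-q^i) · ∏_{i≤a-b} 1/(1-q^i) · ∏_{i≤b} 1/(1-q^i),
-- expanded as a power series in ℤ[[q]].
gaussian : (a b : ℕ) → Series
gaussian a b = (prodTo oneMinusQ a ⊛ prodTo invOneMinusQ (a ∸ b)) ⊛ prodTo invOneMinusQ b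

coeffGauss : (n k α : ℕ) → ℤ
coeffGauss n k α = gaussian (n ℕ.+ k) k α

-- The coefficients of [n+k choose k]_q below q^(n+1) are those of P_k = ∏_{i≤k} 1/(1 - q^i), the generating
-- function of p_{≤k}. If π is a period of P_k modulo N, then h = (1 - q^π) P_k agrees with P_k below q^π and is,
-- modulo N, a polynomial of degree < π with (q;q)_k h = 1 - q^π. Since (q;q)_k has degree (k+1 choose 2) and
-- leading coefficient ±1, comparing top coefficients bounds the degree of h by π - (k+1 choose 2). Since
-- (q;q)_k is palindromic up to (-1)^k and 1 - q^π is antipalindromic, the reversal of h solves the same
-- equation up to the sign (-1)^(k+1), and cancelling (q;q)_k makes h palindromic up to that sign.

module Submission where

open import Defs
open import Data.Nat using (ℕ; suc; _+_; _≤_; _<_)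
open import Data.Nat.Combinatorics using (_C_)
open import Data.Integer using (+_; -1ℤ; _*_; _^_)
open import Data.Product using (_×_)
open import Relation.Binary.PropositionalEquality using (_≡_)

open import Data.Bool using (Bool; true; false; _∧_; if_then_else_)
open import Data.Bool.Properties using (∧-zeroʳ; ∧-assoc)
open import Data.Integer using (ℤ; 0ℤ; 1ℤ; -_) renaming (_+_ to _+ℤ_; _-_ to _-ℤ_)
import Data.Integer.Divisibility.Signed as ℤ∣
import Data.Integer.Properties as ℤP
open import Data.Integer.Tactic.RingSolver using (solve-∀)
open import Data.List using (List; []; _∷_; map; concatMap; applyUpTo; filterᵇ; length; _++_)
open import Data.Nat using (zero; _∸_; z≤n; s≤s; _≤ᵇ_; _≡ᵇ_; _≤?_)
open import Data.Nat.Combinatorics using (nCk+nC[k+1]≡[n+1]C[k+1]; nC1≡n)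
open import Data.Nat.Divisibility using (_∣_; _∣?_; _∣0; n∣n; ∣m∣n⇒∣m+n; ∣m+n∣m⇒∣n; >⇒∤)
open import Data.Nat.Induction using (<-rec)
open import Data.Nat.ListAction using (sum)
import Data.Nat.Properties as ℕP
open import Algebra.Properties.CommutativeSemigroup ℕP.+-commutativeSemigroup using () renaming (interchange to +-interchange)
open import Data.Product using (_,_)
open import Data.Vec using (Vec; []; _∷_)
open import Relation.Binary.Bundles using (Setoid)
import Relation.Binary.Reasoning.Setoid as SetoidReasoning
open import Relation.Binary.PropositionalEquality using (_≗_; refl; sym; trans; cong; cong₂; subst; subst₂; module ≡-Reasoning)
open import Relation.Nullary using (yes; no; ¬_; contradiction)
open import Relation.Nullary.Decidable using (dec-true; dec-false)

sub-interchange : ∀ a b c d → (a -ℤ b) -ℤ (c -ℤ d) ≡ (a -ℤ c) -ℤ (b -ℤ d)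
sub-interchange = solve-∀

data Offset (i m : ℕ) : Set where
  below : m < i → Offset i m
  above : (t : ℕ) → m ≡ i + t → Offset i m

offset : ∀ i m → Offset i m
offset zero    m       = above m refl
offset (suc i) zero    = below (s≤s z≤n)
offset (suc i) (suc m) with offset i m
... | below m<i    = below (s≤s m<i)
... | above t m≡i+t = above t (cong suc m≡i+t)

shift : ℕ → Series → Series
shift zero    x m       = x m
shift (suc i) x zero    = 0ℤ
shift (suc i) x (suc m) = shift i x m

Δ : ℕ → Series → Series
Δ i x m = x m -ℤ shift i x m

-- multiplication by (q;q)_k = (1 - q)(1 - q²)⋯(1 - q^k)
qPoch : ℕ → Series → Series
qPoch zero    x = x
qPoch (suc k) x = Δ (suc k) (qPoch k x)

shift-cong : ∀ i {x y} → x ≗ y → shift i x ≗ shift i y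
shift-cong zero    x≗y m       = x≗y m
shift-cong (suc i) x≗y zero    = refl
shift-cong (suc i) x≗y (suc m) = shift-cong i x≗y m

shift-below : ∀ i x {m} → m < i → shift i x m ≡ 0ℤ
shift-below (suc i) x {zero}  _         = refl
shift-below (suc i) x {suc m} (s≤s m<i) = shift-below i x m<i

shift-+ : ∀ i x t → shift i x (i + t) ≡ x t
shift-+ zero    x t = refl
shift-+ (suc i) x t = shift-+ i x t

shift-shift : ∀ i j x m → shift i (shift j x) m ≡ shift (i + j) x m
shift-shift zero    j x m       = refl
shift-shift (suc i) j x zero    = refl
shift-shift (suc i) j x (suc m) = shift-shift i j x m

shift-sub : ∀ i x y m → shift i (λ t → x t -ℤ y t) m ≡ shift i x m -ℤ shift i y m
shift-sub zero    x y m       = refl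
shift-sub (suc i) x y zero    = refl
shift-sub (suc i) x y (suc m) = shift-sub i x y m

shift-scale : ∀ i c x m → shift i (λ t → c * x t) m ≡ c * shift i x m
shift-scale zero    c x m       = refl
shift-scale (suc i) c x zero    = sym (ℤP.*-zeroʳ c)
shift-scale (suc i) c x (suc m) = shift-scale i c x m

shift-comm : ∀ i j x m → shift i (shift j x) m ≡ shift j (shift i x) m
shift-comm i j x m = begin
  shift i (shift j x) m ≡⟨ shift-shift i j x m ⟩
  shift (i + j) x m     ≡⟨ cong (λ s → shift s x m) (ℕP.+-comm i j) ⟩
  shift (j + i) x m     ≡⟨ shift-shift j i x m ⟨
  shift j (shift i x) m ∎
  where open ≡-Reasoning

Δ-cong : ∀ i {x y} → x ≗ y → Δ i x ≗ Δ i y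
Δ-cong i x≗y m = cong₂ _-ℤ_ (x≗y m) (shift-cong i x≗y m)

Δ-sub : ∀ i x y m → Δ i (λ t → x t -ℤ y t) m ≡ Δ i x m -ℤ Δ i y m
Δ-sub i x y m = trans (cong (x m -ℤ y m -ℤ_) (shift-sub i x y m))
                      (sub-interchange (x m) (y m) (shift i x m) (shift i y m))

Δ-scale : ∀ i c x m → Δ i (λ t → c * x t) m ≡ c * Δ i x m
Δ-scale i c x m = trans (cong (c * x m -ℤ_) (shift-scale i c x m)) (distrib c _ _)
  where
  distrib : ∀ c a b → c * a -ℤ c * b ≡ c * (a -ℤ b)
  distrib = solve-∀

Δ-comm : ∀ i j x m → Δ i (Δ j x) m ≡ Δ j (Δ i x) m
Δ-comm i j x m = begin
  (x m -ℤ shift j x m) -ℤ shift i (Δ j x) m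
    ≡⟨ cong (x m -ℤ shift j x m -ℤ_) (shift-sub i x (shift j x) m) ⟩
  (x m -ℤ shift j x m) -ℤ (shift i x m -ℤ shift i (shift j x) m)
    ≡⟨ cong (λ z → (x m -ℤ shift j x m) -ℤ (shift i x m -ℤ z)) (shift-comm i j x m) ⟩
  (x m -ℤ shift j x m) -ℤ (shift i x m -ℤ shift j (shift i x) m)
    ≡⟨ sub-interchange (x m) (shift j x m) (shift i x m) (shift j (shift i x) m) ⟩
  (x m -ℤ shift i x m) -ℤ (shift j x m -ℤ shift j (shift i x) m)
    ≡⟨ cong (x m -ℤ shift i x m -ℤ_) (shift-sub j x (shift i x) m) ⟨
  (x m -ℤ shift i x m) -ℤ shift j (Δ i x) m
    ∎
  where open ≡-Reasoning

qPoch-cong : ∀ k {x y} → x ≗ y → qPoch k x ≗ qPoch k y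
qPoch-cong zero    x≗y = x≗y
qPoch-cong (suc k) x≗y = Δ-cong (suc k) (qPoch-cong k x≗y)

qPoch-sub : ∀ k x y m → qPoch k (λ t → x t -ℤ y t) m ≡ qPoch k x m -ℤ qPoch k y m
qPoch-sub zero    x y m = refl
qPoch-sub (suc k) x y m =
  trans (Δ-cong (suc k) (qPoch-sub k x y) m) (Δ-sub (suc k) (qPoch k x) (qPoch k y) m)

qPoch-scale : ∀ k c x m → qPoch k (λ t → c * x t) m ≡ c * qPoch k x m
qPoch-scale zero    c x m = refl
qPoch-scale (suc k) c x m =
  trans (Δ-cong (suc k) (qPoch-scale k c x) m) (Δ-scale (suc k) c (qPoch k x) m)

qPoch-Δ : ∀ k i x m → Δ i (qPoch k x) m ≡ qPoch k (Δ i x) m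
qPoch-Δ zero    i x m = refl
qPoch-Δ (suc k) i x m =
  trans (Δ-comm i (suc k) (qPoch k x) m) (Δ-cong (suc k) (qPoch-Δ k i x) m)

triangle : ℕ → ℕ
triangle zero    = 0
triangle (suc k) = triangle k + suc k

[1+k]C2≡triangle : ∀ k → suc k C 2 ≡ triangle k
[1+k]C2≡triangle zero    = refl
[1+k]C2≡triangle (suc k) = begin
  suc (suc k) C 2          ≡⟨ nCk+nC[k+1]≡[n+1]C[k+1] (suc k) 1 ⟨
  suc k C 1 + suc k C 2    ≡⟨ cong₂ _+_ (nC1≡n (suc k)) ([1+k]C2≡triangle k) ⟩
  suc k + triangle k       ≡⟨ ℕP.+-comm (suc k) (triangle k) ⟩
  triangle (suc k)         ∎
  where open ≡-Reasoning

0<triangle : ∀ {k} → 1 ≤ k → 0 < triangle k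
0<triangle {suc k} _ = ℕP.<-≤-trans (s≤s z≤n) (ℕP.m≤n+m (suc k) (triangle k))

[-1]^k*[-1]^k≡1 : ∀ k → (-1ℤ ^ k) * (-1ℤ ^ k) ≡ 1ℤ
[-1]^k*[-1]^k≡1 zero    = refl
[-1]^k*[-1]^k≡1 (suc k) = trans (square (-1ℤ ^ k)) ([-1]^k*[-1]^k≡1 k)
  where
  square : ∀ s → (-1ℤ * s) * (-1ℤ * s) ≡ s * s
  square = solve-∀

-- Cauchy products

sumBelow-cong : ∀ {f g} m → (∀ j → j < m → f j ≡ g j) → sumBelow f m ≡ sumBelow g m
sumBelow-cong zero    f≡g = refl
sumBelow-cong (suc m) f≡g =
  cong₂ _+ℤ_ (sumBelow-cong m (λ j j<m → f≡g j (ℕP.m<n⇒m<1+n j<m))) (f≡g m ℕP.≤-refl)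

sumBelow-zero : ∀ {f} m → (∀ j → f j ≡ 0ℤ) → sumBelow f m ≡ 0ℤ
sumBelow-zero zero    f≡0 = refl
sumBelow-zero (suc m) f≡0 = cong₂ _+ℤ_ (sumBelow-zero m f≡0) (f≡0 m)

sumBelow-suc : ∀ f m → sumBelow f (suc m) ≡ f 0 +ℤ sumBelow (λ j → f (suc j)) m
sumBelow-suc f zero    = trans (ℤP.+-identityˡ (f 0)) (sym (ℤP.+-identityʳ (f 0)))
sumBelow-suc f (suc m) = trans (cong (_+ℤ f (suc m)) (sumBelow-suc f m)) (ℤP.+-assoc (f 0) _ _)

sumBelow-reverse : ∀ f m → sumBelow f (suc m) ≡ sumBelow (λ j → f (m ∸ j)) (suc m)
sumBelow-reverse f zero    = refl
sumBelow-reverse f (suc m) = begin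
  sumBelow f (suc m) +ℤ f (suc m)                      ≡⟨ cong (_+ℤ f (suc m)) (sumBelow-reverse f m) ⟩
  sumBelow (λ j → f (m ∸ j)) (suc m) +ℤ f (suc m)      ≡⟨ ℤP.+-comm _ (f (suc m)) ⟩
  f (suc m) +ℤ sumBelow (λ j → f (m ∸ j)) (suc m)      ≡⟨ sumBelow-suc (λ j → f (suc m ∸ j)) (suc m) ⟨
  sumBelow (λ j → f (suc m ∸ j)) (suc (suc m))         ∎
  where open ≡-Reasoning

sumBelow-sub : ∀ f g m → sumBelow (λ j → f j -ℤ g j) m ≡ sumBelow f m -ℤ sumBelow g m
sumBelow-sub f g zero    = refl
sumBelow-sub f g (suc m) =
  trans (cong (_+ℤ (f m -ℤ g m)) (sumBelow-sub f g m)) (regroup (sumBelow f m) (sumBelow g m) (f m) (g m))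
  where
  regroup : ∀ a b c d → (a -ℤ b) +ℤ (c -ℤ d) ≡ (a +ℤ c) -ℤ (b +ℤ d)
  regroup = solve-∀

⊛-congˡ-upTo : ∀ {f f'} g α → (∀ j → j ≤ α → f j ≡ f' j) → (f ⊛ g) α ≡ (f' ⊛ g) α
⊛-congˡ-upTo g α f≡f' = sumBelow-cong (suc α) (λ j j≤α → cong (_* g (α ∸ j)) (f≡f' j (ℕP.≤-pred j≤α)))

⊛-congʳ : ∀ f {g g'} → g ≗ g' → f ⊛ g ≗ f ⊛ g'
⊛-congʳ f g≗g' α = sumBelow-cong (suc α) (λ j _ → cong (f j *_) (g≗g' (α ∸ j)))

⊛-comm : ∀ f g → f ⊛ g ≗ g ⊛ f
⊛-comm f g α = trans (sumBelow-reverse _ α) (sumBelow-cong (suc α) term)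
  where
  term : ∀ j → j < suc α → f (α ∸ j) * g (α ∸ (α ∸ j)) ≡ g j * f (α ∸ j)
  term j j<1+α = trans (cong (λ i → f (α ∸ j) * g i) (ℕP.m∸[m∸n]≡n (ℕP.≤-pred j<1+α)))
                       (ℤP.*-comm (f (α ∸ j)) (g j))

⊛-identityˡ : ∀ f → one ⊛ f ≗ f
⊛-identityˡ f α = begin
  (one ⊛ f) α                                         ≡⟨ sumBelow-suc _ α ⟩
  1ℤ * f α +ℤ sumBelow (λ j → 0ℤ * f (α ∸ suc j)) α   ≡⟨ cong₂ _+ℤ_ (ℤP.*-identityˡ (f α))
                                                                    (sumBelow-zero α (λ j → ℤP.*-zeroˡ (f (α ∸ suc j)))) ⟩
  f α +ℤ 0ℤ                                           ≡⟨ ℤP.+-identityʳ (f α) ⟩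
  f α                                                 ∎
  where open ≡-Reasoning

⊛-identityʳ : ∀ f → f ⊛ one ≗ f
⊛-identityʳ f α = trans (⊛-comm f one α) (⊛-identityˡ f α)

⊛-sub : ∀ f g h α → (f ⊛ (λ t → g t -ℤ h t)) α ≡ (f ⊛ g) α -ℤ (f ⊛ h) α
⊛-sub f g h α = trans (sumBelow-cong (suc α) (λ j _ → distrib (f j) (g (α ∸ j)) (h (α ∸ j))))
                      (sumBelow-sub _ _ (suc α))
  where
  distrib : ∀ a b c → a * (b -ℤ c) ≡ a * b -ℤ a * c
  distrib = solve-∀

⊛-shift₁ : ∀ f g α → (f ⊛ shift 1 g) α ≡ shift 1 (f ⊛ g) α
⊛-shift₁ f g zero    = trans (ℤP.+-identityˡ _) (ℤP.*-zeroʳ (f 0))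
⊛-shift₁ f g (suc α) = begin
  sumBelow (λ j → f j * shift 1 g (suc α ∸ j)) (suc α) +ℤ f (suc α) * shift 1 g (α ∸ α)
    ≡⟨ cong₂ _+ℤ_ (sumBelow-cong (suc α) (λ j j<1+α →
                     cong (λ i → f j * shift 1 g i) (ℕP.+-∸-assoc 1 (ℕP.≤-pred j<1+α))))
                  (trans (cong (λ i → f (suc α) * shift 1 g i) (ℕP.n∸n≡0 α)) (ℤP.*-zeroʳ (f (suc α)))) ⟩
  (f ⊛ g) α +ℤ 0ℤ
    ≡⟨ ℤP.+-identityʳ _ ⟩
  (f ⊛ g) α
    ∎
  where open ≡-Reasoning

⊛-shift : ∀ i f g α → (f ⊛ shift i g) α ≡ shift i (f ⊛ g) α
⊛-shift zero    f g α = refl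
⊛-shift (suc i) f g α = begin
  (f ⊛ shift (suc i) g) α         ≡⟨ ⊛-congʳ f (shift-shift 1 i g) α ⟨
  (f ⊛ shift 1 (shift i g)) α     ≡⟨ ⊛-shift₁ f (shift i g) α ⟩
  shift 1 (f ⊛ shift i g) α       ≡⟨ shift-cong 1 (⊛-shift i f g) α ⟩
  shift 1 (shift i (f ⊛ g)) α     ≡⟨ shift-shift 1 i (f ⊛ g) α ⟩
  shift (suc i) (f ⊛ g) α         ∎
  where open ≡-Reasoning

⊛-Δ : ∀ i f g α → (f ⊛ Δ i g) α ≡ Δ i (f ⊛ g) α
⊛-Δ i f g α = trans (⊛-sub f g (shift i g) α) (cong ((f ⊛ g) α -ℤ_) (⊛-shift i f g α))

shift-one : ∀ i α → shift i one α ≡ (if α ≡ᵇ i then 1ℤ else 0ℤ)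
shift-one zero    zero    = refl
shift-one zero    (suc α) = refl
shift-one (suc i) zero    = refl
shift-one (suc i) (suc α) = shift-one i α

oneMinusQ-Δ : ∀ i → oneMinusQ i ≗ Δ i one
oneMinusQ-Δ i α = cong (one α -ℤ_) (sym (shift-one i α))

⊛-prodTo-oneMinusQ : ∀ k f → f ⊛ prodTo oneMinusQ k ≗ qPoch k f
⊛-prodTo-oneMinusQ zero    f α = ⊛-identityʳ f α
⊛-prodTo-oneMinusQ (suc k) f α = begin
  (f ⊛ (A ⊛ oneMinusQ (suc k))) α   ≡⟨ ⊛-congʳ f (⊛-congʳ A (oneMinusQ-Δ (suc k))) α ⟩
  (f ⊛ (A ⊛ Δ (suc k) one)) α       ≡⟨ ⊛-congʳ f (λ β → ⊛-Δ (suc k) A one β) α ⟩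
  (f ⊛ Δ (suc k) (A ⊛ one)) α       ≡⟨ ⊛-congʳ f (Δ-cong (suc k) (⊛-identityʳ A)) α ⟩
  (f ⊛ Δ (suc k) A) α               ≡⟨ ⊛-Δ (suc k) f A α ⟩
  Δ (suc k) (f ⊛ A) α               ≡⟨ Δ-cong (suc k) (⊛-prodTo-oneMinusQ k f) α ⟩
  qPoch (suc k) f α                 ∎
  where
  open ≡-Reasoning
  A : Series
  A = prodTo oneMinusQ k

-- The generating function of partitions into at most k parts

invOneMinusQ-∣ : ∀ i {α} → i ∣ α → invOneMinusQ i α ≡ 1ℤ
invOneMinusQ-∣ i {α} i∣α = cong (if_then 1ℤ else 0ℤ) (dec-true (i ∣? α) i∣α)

invOneMinusQ-∤ : ∀ i {α} → ¬ i ∣ α → invOneMinusQ i α ≡ 0ℤ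
invOneMinusQ-∤ i {α} i∤α = cong (if_then 1ℤ else 0ℤ) (dec-false (i ∣? α) i∤α)

invOneMinusQ-+ : ∀ i α → invOneMinusQ i (i + α) ≡ invOneMinusQ i α
invOneMinusQ-+ i α with i ∣? α
... | yes i∣α = invOneMinusQ-∣ i (∣m∣n⇒∣m+n n∣n i∣α)
... | no  i∤α = invOneMinusQ-∤ i (λ i∣i+α → i∤α (∣m+n∣m⇒∣n i∣i+α n∣n))

Δ-invOneMinusQ : ∀ k → Δ (suc k) (invOneMinusQ (suc k)) ≗ one
Δ-invOneMinusQ k α with offset (suc k) α
... | below α<1+k = trans (cong (invOneMinusQ (suc k) α -ℤ_) (shift-below (suc k) _ α<1+k))
                          (trans (ℤP.+-identityʳ _) (low α α<1+k))
  where
  low : ∀ α → α < suc k → invOneMinusQ (suc k) α ≡ one α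
  low zero    _     = invOneMinusQ-∣ (suc k) (suc k ∣0)
  low (suc α) α<1+k = invOneMinusQ-∤ (suc k) (>⇒∤ α<1+k)
... | above t refl = trans (cong₂ _-ℤ_ (invOneMinusQ-+ (suc k) t) (shift-+ (suc k) _ t))
                           (ℤP.+-inverseʳ (invOneMinusQ (suc k) t))

partitionSeries : ℕ → Series
partitionSeries = prodTo invOneMinusQ

Δ-partitionSeries : ∀ k → Δ (suc k) (partitionSeries (suc k)) ≗ partitionSeries k
Δ-partitionSeries k α = begin
  Δ (suc k) (p≤k ⊛ invOneMinusQ (suc k)) α   ≡⟨ ⊛-Δ (suc k) p≤k (invOneMinusQ (suc k)) α ⟨
  (p≤k ⊛ Δ (suc k) (invOneMinusQ (suc k))) α ≡⟨ ⊛-congʳ p≤k (Δ-invOneMinusQ k) α ⟩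
  (p≤k ⊛ one) α                              ≡⟨ ⊛-identityʳ p≤k α ⟩
  p≤k α                                      ∎
  where
  open ≡-Reasoning
  p≤k : Series
  p≤k = partitionSeries k

qPoch-partitionSeries : ∀ k → qPoch k (partitionSeries k) ≗ one
qPoch-partitionSeries zero    α = refl
qPoch-partitionSeries (suc k) α = begin
  Δ (suc k) (qPoch k (partitionSeries (suc k))) α  ≡⟨ qPoch-Δ k (suc k) _ α ⟩
  qPoch k (Δ (suc k) (partitionSeries (suc k))) α  ≡⟨ qPoch-cong k (Δ-partitionSeries k) α ⟩
  qPoch k (partitionSeries k) α                    ≡⟨ qPoch-partitionSeries k α ⟩
  one α                                            ∎
  where open ≡-Reasoning

Δ-below : ∀ i x {m} → m < i → Δ i x m ≡ x m
Δ-below i x m<i = trans (cong (x _ -ℤ_) (shift-below i x m<i)) (ℤP.+-identityʳ (x _))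

qPoch-+-below : ∀ j n x {α} → α ≤ n → qPoch (j + n) x α ≡ qPoch n x α
qPoch-+-below zero    n x α≤n = refl
qPoch-+-below (suc j) n x α≤n =
  trans (Δ-below (suc (j + n)) (qPoch (j + n) x) (s≤s (ℕP.≤-trans α≤n (ℕP.m≤n+m n j)))) (qPoch-+-below j n x α≤n)

-- gaussian (n + k) k = ∏_{n<i≤n+k} (1 - q^i) · partitionSeries k, and the product is 1 up to degree n.
coeffGauss-partitionSeries : ∀ n k {α} → α ≤ n → coeffGauss n k α ≡ partitionSeries k α
coeffGauss-partitionSeries n k {α} α≤n = begin
  coeffGauss n k α
    ≡⟨ cong (λ d → ((A ⊛ partitionSeries d) ⊛ partitionSeries k) α) (ℕP.m+n∸n≡m n k) ⟩
  ((A ⊛ partitionSeries n) ⊛ partitionSeries k) α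
    ≡⟨ ⊛-congˡ-upTo (partitionSeries k) α (λ j j≤α → lowOne (ℕP.≤-trans j≤α α≤n)) ⟩
  (one ⊛ partitionSeries k) α
    ≡⟨ ⊛-identityˡ (partitionSeries k) α ⟩
  partitionSeries k α
    ∎
  where
  open ≡-Reasoning
  A : Series
  A = prodTo oneMinusQ (n + k)
  lowOne : ∀ {j} → j ≤ n → (A ⊛ partitionSeries n) j ≡ one j
  lowOne {j} j≤n = begin
    (A ⊛ partitionSeries n) j           ≡⟨ ⊛-comm A (partitionSeries n) j ⟩
    (partitionSeries n ⊛ A) j           ≡⟨ ⊛-prodTo-oneMinusQ (n + k) (partitionSeries n) j ⟩
    qPoch (n + k) (partitionSeries n) j ≡⟨ cong (λ d → qPoch d (partitionSeries n) j) (ℕP.+-comm n k) ⟩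
    qPoch (k + n) (partitionSeries n) j ≡⟨ qPoch-+-below k n (partitionSeries n) j≤n ⟩
    qPoch n (partitionSeries n) j       ≡⟨ qPoch-partitionSeries n j ⟩
    one j                               ∎

-- Reversal of polynomials

≤ᵇ-true : ∀ {m n} → m ≤ n → (m ≤ᵇ n) ≡ true
≤ᵇ-true {m} {n} = dec-true (m ≤? n)

≤ᵇ-false : ∀ {m n} → n < m → (m ≤ᵇ n) ≡ false
≤ᵇ-false {m} {n} n<m = dec-false (m ≤? n) (ℕP.<⇒≱ n<m)

suc-≤ᵇ-suc : ∀ a m → (suc a ≤ᵇ suc m) ≡ (a ≤ᵇ m)
suc-≤ᵇ-suc zero    m = refl
suc-≤ᵇ-suc (suc a) m = refl

-- the coefficient of q^m in q^E · x(1/q)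
reverse : ℕ → Series → Series
reverse E x m = if m ≤ᵇ E then x (E ∸ m) else 0ℤ

reverse-≤ : ∀ E x {m} → m ≤ E → reverse E x m ≡ x (E ∸ m)
reverse-≤ E x {m} m≤E = cong (if_then x (E ∸ m) else 0ℤ) (≤ᵇ-true m≤E)

reverse-> : ∀ E x {m} → E < m → reverse E x m ≡ 0ℤ
reverse-> E x {m} E<m = cong (if_then x (E ∸ m) else 0ℤ) (≤ᵇ-false E<m)

reverse-sub : ∀ E x y m → reverse E (λ t → x t -ℤ y t) m ≡ reverse E x m -ℤ reverse E y m
reverse-sub E x y m with m ≤ᵇ E
... | true  = refl
... | false = refl

reverse-+ : ∀ i E x t → reverse (i + E) x (i + t) ≡ reverse E x t
reverse-+ zero    E x t = refl
reverse-+ (suc i) E x t =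
  trans (cong (if_then x (i + E ∸ (i + t)) else 0ℤ) (suc-≤ᵇ-suc (i + t) (i + E))) (reverse-+ i E x t)

reverse-shift : ∀ i E x → reverse (i + E) (shift i x) ≗ reverse E x
reverse-shift zero    E x m = refl
reverse-shift (suc i) E x m with m ≤? E
... | yes m≤E = begin
  reverse (suc i + E) (shift (suc i) x) m
    ≡⟨ reverse-≤ (suc i + E) (shift (suc i) x) (ℕP.≤-trans m≤E (ℕP.m≤n+m E (suc i))) ⟩
  shift (suc i) x (suc i + E ∸ m)
    ≡⟨ cong (shift (suc i) x) (ℕP.+-∸-assoc (suc i) m≤E) ⟩
  shift (suc i) x (suc i + (E ∸ m))
    ≡⟨ shift-+ (suc i) x (E ∸ m) ⟩
  x (E ∸ m)
    ≡⟨ reverse-≤ E x m≤E ⟨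
  reverse E x m
    ∎
  where open ≡-Reasoning
... | no m≰E = begin
  reverse (suc i + E) (shift (suc i) x) m
    ≡⟨ cong (if m ≤ᵇ suc i + E then_else 0ℤ) (shift-below (suc i) x far) ⟩
  (if m ≤ᵇ suc i + E then 0ℤ else 0ℤ)
    ≡⟨ if-0 (m ≤ᵇ suc i + E) ⟩
  0ℤ
    ≡⟨ reverse-> E x E<m ⟨
  reverse E x m
    ∎
  where
  open ≡-Reasoning
  E<m : E < m
  E<m = ℕP.≰⇒> m≰E
  far : suc i + E ∸ m < suc i
  far = ℕP.m<n+o⇒m∸n<o (suc i + E) m (subst (_< m + suc i) (ℕP.+-comm E (suc i)) (ℕP.+-monoˡ-< (suc i) E<m))
  if-0 : ∀ b → (if b then 0ℤ else 0ℤ) ≡ 0ℤ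
  if-0 true  = refl
  if-0 false = refl

-- Congruences modulo N

module Modulo (N : ℕ) where

  -- a record rather than the bare divisibility, so that a and b can be inferred
  infix 4 _≈_
  record _≈_ (a b : ℤ) : Set where
    constructor mk≈
    field divides : + N ℤ∣.∣ a -ℤ b
  open _≈_ public

  ≡⇒≈ : ∀ {a b} → a ≡ b → a ≈ b
  ≡⇒≈ {a} refl = mk≈ (subst (+ N ℤ∣.∣_) (sym (ℤP.+-inverseʳ a)) (ℤ∣.divides 0ℤ refl))

  ≈-sym : ∀ {a b} → a ≈ b → b ≈ a
  ≈-sym {a} {b} (mk≈ N∣a-b) = mk≈ (subst (+ N ℤ∣.∣_) (negate a b) (ℤ∣.∣m⇒∣-m N∣a-b))
    where
    negate : ∀ a b → - (a -ℤ b) ≡ b -ℤ a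
    negate = solve-∀

  ≈-trans : ∀ {a b c} → a ≈ b → b ≈ c → a ≈ c
  ≈-trans {a} {b} {c} (mk≈ N∣a-b) (mk≈ N∣b-c) =
    mk≈ (subst (+ N ℤ∣.∣_) (telescope a b c) (ℤ∣.∣m∣n⇒∣m+n N∣a-b N∣b-c))
    where
    telescope : ∀ a b c → (a -ℤ b) +ℤ (b -ℤ c) ≡ a -ℤ c
    telescope = solve-∀

  ≈-setoid : Setoid _ _
  ≈-setoid = record { _≈_ = _≈_ ; isEquivalence = record { refl = ≡⇒≈ refl ; sym = ≈-sym ; trans = ≈-trans } }

  module ≈-Reasoning = SetoidReasoning ≈-setoid

  ≡[mod]⇒≈ : ∀ {a b} → a ≡[mod N ] b → a ≈ b
  ≡[mod]⇒≈ a≡b = mk≈ (ℤ∣.∣ᵤ⇒∣ a≡b)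

  ≈⇒≡[mod] : ∀ {a b} → a ≈ b → a ≡[mod N ] b
  ≈⇒≡[mod] a≈b = ℤ∣.∣⇒∣ᵤ (divides a≈b)

  -‿cong : ∀ {a b} → a ≈ b → - a ≈ - b
  -‿cong {a} {b} (mk≈ N∣a-b) = mk≈ (subst (+ N ℤ∣.∣_) (negate a b) (ℤ∣.∣m⇒∣-m N∣a-b))
    where
    negate : ∀ a b → - (a -ℤ b) ≡ - a -ℤ - b
    negate = solve-∀

  +-cong : ∀ {a b c d} → a ≈ b → c ≈ d → a +ℤ c ≈ b +ℤ d
  +-cong {a} {b} {c} {d} (mk≈ N∣a-b) (mk≈ N∣c-d) =
    mk≈ (subst (+ N ℤ∣.∣_) (regroup a b c d) (ℤ∣.∣m∣n⇒∣m+n N∣a-b N∣c-d))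
    where
    regroup : ∀ a b c d → (a -ℤ b) +ℤ (c -ℤ d) ≡ (a +ℤ c) -ℤ (b +ℤ d)
    regroup = solve-∀

  -‿cong₂ : ∀ {a b c d} → a ≈ b → c ≈ d → a -ℤ c ≈ b -ℤ d
  -‿cong₂ a≈b c≈d = +-cong a≈b (-‿cong c≈d)

  *-congˡ : ∀ c {a b} → a ≈ b → c * a ≈ c * b
  *-congˡ c {a} {b} (mk≈ N∣a-b) = mk≈ (subst (+ N ℤ∣.∣_) (distrib c a b) (ℤ∣.∣n⇒∣m*n c N∣a-b))
    where
    distrib : ∀ c a b → c * (a -ℤ b) ≡ c * a -ℤ c * b
    distrib = solve-∀

  infix 4 _≋_
  _≋_ : Series → Series → Set
  x ≋ y = ∀ m → x m ≈ y m

  shift-cong≈ : ∀ i {x y} → x ≋ y → shift i x ≋ shift i y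
  shift-cong≈ zero    x≋y m       = x≋y m
  shift-cong≈ (suc i) x≋y zero    = ≡⇒≈ refl
  shift-cong≈ (suc i) x≋y (suc m) = shift-cong≈ i x≋y m

  Δ-cong≈ : ∀ i {x y} → x ≋ y → Δ i x ≋ Δ i y
  Δ-cong≈ i x≋y m = -‿cong₂ (x≋y m) (shift-cong≈ i x≋y m)

  Δ-cancel : ∀ {i} w → 0 < i → Δ i w ≋ (λ _ → 0ℤ) → w ≋ (λ _ → 0ℤ)
  Δ-cancel {i} w 0<i Δw≈0 = <-rec _ step
    where
    open ≈-Reasoning
    shift≈0 : ∀ m → (∀ {t} → t < m → w t ≈ 0ℤ) → shift i w m ≈ 0ℤ
    shift≈0 m rec with offset i m
    ... | below m<i    = ≡⇒≈ (shift-below i w m<i)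
    ... | above t refl = ≈-trans (≡⇒≈ (shift-+ i w t)) (rec (ℕP.m<n+m t 0<i))
    step : ∀ m → (∀ {t} → t < m → w t ≈ 0ℤ) → w m ≈ 0ℤ
    step m rec = begin
      w m                           ≡⟨ unfold (w m) (shift i w m) ⟩
      Δ i w m +ℤ shift i w m        ≈⟨ +-cong (Δw≈0 m) (shift≈0 m rec) ⟩
      0ℤ +ℤ 0ℤ                      ≡⟨⟩
      0ℤ                            ∎
      where
      unfold : ∀ a b → a ≡ (a -ℤ b) +ℤ b
      unfold = solve-∀

  DegreeAtMost : ℕ → Series → Set
  DegreeAtMost e x = ∀ m → e < m → x m ≈ 0ℤ

  shift-degree : ∀ i {e x} → DegreeAtMost e x → DegreeAtMost (i + e) (shift i x)
  shift-degree i {e} {x} deg m i+e<m with offset i m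
  ... | below m<i    = ≡⇒≈ (shift-below i x m<i)
  ... | above t refl = ≈-trans (≡⇒≈ (shift-+ i x t)) (deg t (ℕP.+-cancelˡ-< i e t i+e<m))

  Δ-degree : ∀ i {e x} → DegreeAtMost e x → DegreeAtMost (e + i) (Δ i x)
  Δ-degree i {e} {x} deg m e+i<m =
    -‿cong₂ (deg m (ℕP.≤-<-trans (ℕP.m≤m+n e i) e+i<m))
            (shift-degree i deg m (subst (_< m) (ℕP.+-comm e i) e+i<m))

  Δ-top : ∀ {i e x} → 0 < i → DegreeAtMost e x → Δ i x (e + i) ≈ - x e
  Δ-top {i} {e} {x} 0<i deg = begin
    x (e + i) -ℤ shift i x (e + i) ≈⟨ -‿cong₂ (deg (e + i) (ℕP.m<m+n e 0<i)) (≡⇒≈ shift-top) ⟩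
    0ℤ -ℤ x e                      ≡⟨ ℤP.+-identityˡ (- x e) ⟩
    - x e                          ∎
    where
    open ≈-Reasoning
    shift-top : shift i x (e + i) ≡ x e
    shift-top = trans (cong (shift i x) (ℕP.+-comm e i)) (shift-+ i x e)

  qPoch-degree : ∀ k {e x} → DegreeAtMost e x → DegreeAtMost (e + triangle k) (qPoch k x)
  qPoch-degree zero    {e} deg m lt = deg m (subst (_< m) (ℕP.+-identityʳ e) lt)
  qPoch-degree (suc k) {e} deg m lt =
    Δ-degree (suc k) (qPoch-degree k deg) m (subst (_< m) (sym (ℕP.+-assoc e (triangle k) (suc k))) lt)

  qPoch-top : ∀ k {e x} → DegreeAtMost e x → qPoch k x (e + triangle k) ≈ (-1ℤ ^ k) * x e
  qPoch-top zero    {e} {x} deg = ≡⇒≈ (trans (cong x (ℕP.+-identityʳ e)) (sym (ℤP.*-identityˡ (x e))))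
  qPoch-top (suc k) {e} {x} deg = begin
    qPoch (suc k) x (e + triangle (suc k))       ≡⟨ cong (qPoch (suc k) x) (ℕP.+-assoc e (triangle k) (suc k)) ⟨
    Δ (suc k) (qPoch k x) (e + triangle k + suc k) ≈⟨ Δ-top (s≤s z≤n) (qPoch-degree k deg) ⟩
    - qPoch k x (e + triangle k)                 ≈⟨ -‿cong (qPoch-top k deg) ⟩
    - ((-1ℤ ^ k) * x e)                          ≡⟨ sign (-1ℤ ^ k) (x e) ⟩
    (-1ℤ ^ suc k) * x e                          ∎
    where
    open ≈-Reasoning
    sign : ∀ s a → - (s * a) ≡ (-1ℤ * s) * a
    sign = solve-∀

  reverse-cong≈ : ∀ E {x y} → x ≋ y → reverse E x ≋ reverse E y
  reverse-cong≈ E x≋y m with m ≤ᵇ E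
  ... | true  = x≋y (E ∸ m)
  ... | false = ≡⇒≈ refl

  reverse-degree : ∀ i E {x} → DegreeAtMost E x → reverse (i + E) x ≋ shift i (reverse E x)
  reverse-degree i E {x} deg m with offset i m
  ... | below m<i = begin
    reverse (i + E) x m    ≡⟨ reverse-≤ (i + E) x (ℕP.≤-trans (ℕP.<⇒≤ m<i) (ℕP.m≤m+n i E)) ⟩
    x (i + E ∸ m)          ≈⟨ deg (i + E ∸ m) beyond ⟩
    0ℤ                     ≡⟨ shift-below i (reverse E x) m<i ⟨
    shift i (reverse E x) m ∎
    where
    open ≈-Reasoning
    beyond : E < i + E ∸ m
    beyond = subst (E <_) (sym (ℕP.+-∸-comm E (ℕP.<⇒≤ m<i))) (ℕP.m<n+m E (ℕP.m<n⇒0<n∸m m<i))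
  ... | above t refl = ≡⇒≈ (trans (reverse-+ i E x t) (sym (shift-+ i (reverse E x) t)))

  Δ-reverse : ∀ i E {x} → DegreeAtMost E x → Δ i (reverse E x) ≋ (λ m → - reverse (E + i) (Δ i x) m)
  Δ-reverse i E {x} deg m = begin
    reverse E x m -ℤ shift i (reverse E x) m
      ≈⟨ -‿cong₂ (≡⇒≈ (reverse-shift i E x m)) (reverse-degree i E deg m) ⟨
    reverse (i + E) (shift i x) m -ℤ reverse (i + E) x m
      ≡⟨ flip (reverse (i + E) x m) (reverse (i + E) (shift i x) m) ⟩
    - (reverse (i + E) x m -ℤ reverse (i + E) (shift i x) m)
      ≡⟨ cong -_ (reverse-sub (i + E) x (shift i x) m) ⟨
    - reverse (i + E) (Δ i x) m
      ≡⟨ cong (λ d → - reverse d (Δ i x) m) (ℕP.+-comm i E) ⟩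
    - reverse (E + i) (Δ i x) m
      ∎
    where
    open ≈-Reasoning
    flip : ∀ a b → b -ℤ a ≡ - (a -ℤ b)
    flip = solve-∀

  qPoch-reverse : ∀ k E {x} → DegreeAtMost E x →
                  qPoch k (reverse E x) ≋ (λ m → (-1ℤ ^ k) * reverse (E + triangle k) (qPoch k x) m)
  qPoch-reverse zero    E {x} deg m =
    ≡⇒≈ (trans (cong (λ d → reverse d x m) (sym (ℕP.+-identityʳ E))) (sym (ℤP.*-identityˡ _)))
  qPoch-reverse (suc k) E {x} deg m = begin
    Δ (suc k) (qPoch k (reverse E x)) m
      ≈⟨ Δ-cong≈ (suc k) (qPoch-reverse k E deg) m ⟩
    Δ (suc k) (λ t → s * reverse E′ (qPoch k x) t) m
      ≡⟨ Δ-scale (suc k) s (reverse E′ (qPoch k x)) m ⟩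
    s * Δ (suc k) (reverse E′ (qPoch k x)) m
      ≈⟨ *-congˡ s (Δ-reverse (suc k) E′ (qPoch-degree k deg) m) ⟩
    s * - reverse (E′ + suc k) (qPoch (suc k) x) m
      ≡⟨ sign s _ ⟩
    (-1ℤ ^ suc k) * reverse (E′ + suc k) (qPoch (suc k) x) m
      ≡⟨ cong (λ d → (-1ℤ ^ suc k) * reverse d (qPoch (suc k) x) m) (ℕP.+-assoc E (triangle k) (suc k)) ⟩
    (-1ℤ ^ suc k) * reverse (E + triangle (suc k)) (qPoch (suc k) x) m
      ∎
    where
    open ≈-Reasoning
    s : ℤ
    s = -1ℤ ^ k
    E′ : ℕ
    E′ = E + triangle k
    sign : ∀ s a → s * - a ≡ (-1ℤ * s) * a
    sign = solve-∀

  qPoch-cancel : ∀ k {w} → qPoch k w ≋ (λ _ → 0ℤ) → w ≋ (λ _ → 0ℤ)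
  qPoch-cancel zero    qPoch-w≈0 = qPoch-w≈0
  qPoch-cancel (suc k) qPoch-w≈0 = qPoch-cancel k (Δ-cancel _ (s≤s z≤n) qPoch-w≈0)

  module QuotientOfOneMinusQ (k P : ℕ) (h : Series) (h-degree : ∀ m → P ≤ m → h m ≈ 0ℤ)
                             (qPoch-h : qPoch k h ≋ Δ P one) where

    one-degree : DegreeAtMost 0 one
    one-degree (suc m) _ = ≡⇒≈ refl

    reverse-oneMinusQ : reverse P (Δ P one) ≋ (λ m → - Δ P one m)
    reverse-oneMinusQ m = begin
      reverse P (Δ P one) m          ≡⟨ ℤP.neg-involutive _ ⟨
      - - reverse P (Δ P one) m      ≈⟨ -‿cong (Δ-reverse P 0 one-degree m) ⟨
      - Δ P (reverse 0 one) m        ≡⟨ cong -_ (Δ-cong P reverse-one m) ⟩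
      - Δ P one m                    ∎
      where
      open ≈-Reasoning
      reverse-one : reverse 0 one ≗ one
      reverse-one zero    = refl
      reverse-one (suc m) = refl

    top-coefficients-vanish : ∀ m → P < m + triangle k → h m ≈ 0ℤ
    top-coefficients-vanish m = vanish P m (ℕP.m≤n+m P m)
      where
      -- downward induction on m; the coefficient of q^(m + triangle k) in (q;q)_k h is ± h m
      vanish : ∀ d m → P ≤ m + d → P < m + triangle k → h m ≈ 0ℤ
      vanish zero    m P≤m+0 _   = h-degree m (subst (P ≤_) (ℕP.+-identityʳ m) P≤m+0)
      vanish (suc d) m P≤m+1+d P<m+t = begin
        h m                                   ≡⟨ unsign (h m) ⟩
        s * (s * h m)                         ≈⟨ *-congˡ s (qPoch-top k above-m) ⟨
        s * qPoch k h (m + triangle k)        ≈⟨ *-congˡ s (qPoch-h (m + triangle k)) ⟩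
        s * Δ P one (m + triangle k)          ≈⟨ *-congˡ s (Δ-degree P one-degree (m + triangle k) P<m+t) ⟩
        s * 0ℤ                                ≡⟨ ℤP.*-zeroʳ s ⟩
        0ℤ                                    ∎
        where
        open ≈-Reasoning
        s : ℤ
        s = -1ℤ ^ k
        unsign : ∀ a → a ≡ s * (s * a)
        unsign a = sym (trans (sym (ℤP.*-assoc s s a)) (trans (cong (_* a) ([-1]^k*[-1]^k≡1 k)) (ℤP.*-identityˡ a)))
        above-m : DegreeAtMost m h
        above-m m′ m<m′ =
          vanish d m′ (ℕP.≤-trans P≤m+1+d (subst (_≤ m′ + d) (sym (ℕP.+-suc m d)) (ℕP.+-monoˡ-≤ d m<m′)))
                      (ℕP.<-≤-trans P<m+t (ℕP.+-monoˡ-≤ (triangle k) (ℕP.<⇒≤ m<m′)))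

    coefficients-palindromic : ∀ i j → i + j + triangle k ≡ P → h i ≈ (-1ℤ ^ suc k) * h j
    coefficients-palindromic i j i+j+t≡P = begin
      h i                                    ≡⟨ cong h (ℕP.m+n∸n≡m i j) ⟨
      h (i + j ∸ j)                          ≡⟨ reverse-≤ (i + j) h (ℕP.m≤n+m j i) ⟨
      reverse (i + j) h j                    ≡⟨ unfold (reverse (i + j) h j) (s′ * h j) ⟩
      w j +ℤ s′ * h j                        ≈⟨ +-cong (qPoch-cancel k qPoch-w j) (≡⇒≈ refl) ⟩
      0ℤ +ℤ s′ * h j                         ≡⟨ ℤP.+-identityˡ (s′ * h j) ⟩
      s′ * h j                               ∎
      where
      open ≈-Reasoning
      s s′ : ℤ
      s = -1ℤ ^ k
      s′ = -1ℤ ^ suc k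
      w : Series
      w t = reverse (i + j) h t -ℤ s′ * h t
      unfold : ∀ a b → a ≡ (a -ℤ b) +ℤ b
      unfold = solve-∀
      h-degree′ : DegreeAtMost (i + j) h
      h-degree′ m i+j<m = top-coefficients-vanish m (subst (_< m + triangle k) i+j+t≡P (ℕP.+-monoˡ-< (triangle k) i+j<m))
      qPoch-w : qPoch k w ≋ (λ _ → 0ℤ)
      qPoch-w m = begin
        qPoch k w m
          ≡⟨ trans (qPoch-sub k _ _ m) (cong (qPoch k (reverse (i + j) h) m -ℤ_) (qPoch-scale k s′ h m)) ⟩
        qPoch k (reverse (i + j) h) m -ℤ s′ * qPoch k h m
          ≈⟨ -‿cong₂ (qPoch-reverse k (i + j) h-degree′ m) (*-congˡ s′ (qPoch-h m)) ⟩
        s * reverse (i + j + triangle k) (qPoch k h) m -ℤ s′ * Δ P one m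
          ≡⟨ cong (λ d → s * reverse d (qPoch k h) m -ℤ s′ * Δ P one m) i+j+t≡P ⟩
        s * reverse P (qPoch k h) m -ℤ s′ * Δ P one m
          ≈⟨ -‿cong₂ (*-congˡ s (≈-trans (reverse-cong≈ P qPoch-h m) (reverse-oneMinusQ m))) (≡⇒≈ refl) ⟩
        s * - Δ P one m -ℤ s′ * Δ P one m
          ≡⟨ cancel s (Δ P one m) ⟩
        0ℤ
          ∎
        where
        cancel : ∀ s a → s * - a -ℤ (-1ℤ * s) * a ≡ 0ℤ
        cancel = solve-∀

-- Counting partitions

count : {A : Set} → (A → Bool) → List A → ℕ
count p xs = length (filterᵇ p xs)

module _ {A : Set} where

  count-cong : ∀ {p q : A → Bool} xs → (∀ x → p x ≡ q x) → count p xs ≡ count q xs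
  count-cong {p} {q} []       p≡q = refl
  count-cong {p} {q} (x ∷ xs) p≡q with p x | q x | p≡q x
  ... | true  | true  | refl = cong suc (count-cong xs p≡q)
  ... | false | false | refl = count-cong xs p≡q

  count-++ : ∀ (p : A → Bool) xs ys → count p (xs ++ ys) ≡ count p xs + count p ys
  count-++ p []       ys = refl
  count-++ p (x ∷ xs) ys with p x
  ... | true  = cong suc (count-++ p xs ys)
  ... | false = count-++ p xs ys

  count-map : ∀ {B : Set} (p : B → Bool) (f : A → B) xs → count p (map f xs) ≡ count (λ x → p (f x)) xs
  count-map p f []       = refl
  count-map p f (x ∷ xs) with p (f x)
  ... | true  = cong suc (count-map p f xs)
  ... | false = count-map p f xs

  count-∧ : ∀ b (p : A → Bool) xs → count (λ x → b ∧ p x) xs ≡ (if b then count p xs else 0)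
  count-∧ true  p xs       = refl
  count-∧ false p []       = refl
  count-∧ false p (x ∷ xs) = count-∧ false p xs

sumUpTo : (ℕ → ℕ) → ℕ → ℕ
sumUpTo F n = sum (applyUpTo F n)

sumUpTo-cong : ∀ {F G} n → (∀ a → a < n → F a ≡ G a) → sumUpTo F n ≡ sumUpTo G n
sumUpTo-cong zero    F≡G = refl
sumUpTo-cong (suc n) F≡G = cong₂ _+_ (F≡G 0 (s≤s z≤n)) (sumUpTo-cong n (λ a a<n → F≡G (suc a) (s≤s a<n)))

sumUpTo-zero : ∀ {F} n → (∀ a → F a ≡ 0) → sumUpTo F n ≡ 0
sumUpTo-zero zero    F≡0 = refl
sumUpTo-zero (suc n) F≡0 = cong₂ _+_ (F≡0 0) (sumUpTo-zero n (λ a → F≡0 (suc a)))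

sumUpTo-+ : ∀ F G n → sumUpTo (λ a → F a + G a) n ≡ sumUpTo F n + sumUpTo G n
sumUpTo-+ F G zero    = refl
sumUpTo-+ F G (suc n) = begin
  F 0 + G 0 + sumUpTo (λ a → F (suc a) + G (suc a)) n
    ≡⟨ cong (λ z → F 0 + G 0 + z) (sumUpTo-+ (λ a → F (suc a)) (λ a → G (suc a)) n) ⟩
  F 0 + G 0 + (sumUpTo (λ a → F (suc a)) n + sumUpTo (λ a → G (suc a)) n)
    ≡⟨ +-interchange (F 0) (G 0) _ _ ⟩
  F 0 + sumUpTo (λ a → F (suc a)) n + (G 0 + sumUpTo (λ a → G (suc a)) n)
    ∎
  where open ≡-Reasoning

sumUpTo-truncate : ∀ {F} L n → L ≤ n → (∀ a → L ≤ a → F a ≡ 0) → sumUpTo F n ≡ sumUpTo F L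
sumUpTo-truncate zero    n       _         F≡0 = sumUpTo-zero n (λ a → F≡0 a z≤n)
sumUpTo-truncate (suc L) (suc n) (s≤s L≤n) F≡0 =
  cong (λ z → _ + z) (sumUpTo-truncate L n L≤n (λ a L≤a → F≡0 (suc a) (s≤s L≤a)))

sumUpTo-if : ∀ b F n → sumUpTo (λ a → if b then F a else 0) n ≡ (if b then sumUpTo F n else 0)
sumUpTo-if true  F n = refl
sumUpTo-if false F n = sumUpTo-zero n (λ _ → refl)

sumUpTo-guard : ∀ F c n → c < n → sumUpTo (λ a → if a ≤ᵇ c then F a else 0) n ≡ sumUpTo F (suc c)
sumUpTo-guard F c n c<n = begin
  sumUpTo G n       ≡⟨ sumUpTo-truncate (suc c) n c<n (λ a c<a → cong (if_then F a else 0) (≤ᵇ-false c<a)) ⟩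
  sumUpTo G (suc c) ≡⟨ sumUpTo-cong (suc c) (λ a a<1+c → cong (if_then F a else 0) (≤ᵇ-true (ℕP.≤-pred a<1+c))) ⟩
  sumUpTo F (suc c) ∎
  where
  open ≡-Reasoning
  G : ℕ → ℕ
  G a = if a ≤ᵇ c then F a else 0

+-≡ᵇ : ∀ a s m → (a + s ≡ᵇ m) ≡ ((a ≤ᵇ m) ∧ (s ≡ᵇ m ∸ a))
+-≡ᵇ zero    s m       = refl
+-≡ᵇ (suc a) s zero    = refl
+-≡ᵇ (suc a) s (suc m) = trans (+-≡ᵇ a s m) (cong (_∧ (s ≡ᵇ m ∸ a)) (sym (suc-≤ᵇ-suc a m)))

-- number of partitions of m into at most k parts, each part at most c; the sum runs over the largest part a
boundedPartitions : ℕ → ℕ → ℕ → ℕ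
boundedPartitions zero    c zero    = 1
boundedPartitions zero    c (suc m) = 0
boundedPartitions (suc k) c m       = sumUpTo (λ a → if a ≤ᵇ m then boundedPartitions k a (m ∸ a) else 0) (suc c)

headAtMost : ∀ {k} → ℕ → Vec ℕ k → Bool
headAtMost c []      = true
headAtMost c (b ∷ v) = b ≤ᵇ c

partitionOfᵇ : ∀ {k} → ℕ → Vec ℕ k → Bool
partitionOfᵇ m v = nonincreasing v ∧ (vsum v ≡ᵇ m)

partitionᵇ : ∀ {k} → ℕ → ℕ → Vec ℕ k → Bool
partitionᵇ c m v = headAtMost c v ∧ partitionOfᵇ m v

partitionOfᵇ-∷ : ∀ {k} a m (w : Vec ℕ k) → partitionOfᵇ m (a ∷ w) ≡ (a ≤ᵇ m) ∧ partitionᵇ a (m ∸ a) w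
partitionOfᵇ-∷ a m w = begin
  nonincreasing (a ∷ w) ∧ (a + vsum w ≡ᵇ m)
    ≡⟨ cong₂ _∧_ (nonincreasing-∷ w) (+-≡ᵇ a (vsum w) m) ⟩
  (headAtMost a w ∧ nonincreasing w) ∧ ((a ≤ᵇ m) ∧ (vsum w ≡ᵇ m ∸ a))
    ≡⟨ rearrange (headAtMost a w) (nonincreasing w) (a ≤ᵇ m) _ ⟩
  (a ≤ᵇ m) ∧ partitionᵇ a (m ∸ a) w
    ∎
  where
  open ≡-Reasoning
  nonincreasing-∷ : ∀ {k} (w : Vec ℕ k) → nonincreasing (a ∷ w) ≡ headAtMost a w ∧ nonincreasing w
  nonincreasing-∷ []      = refl
  nonincreasing-∷ (b ∷ w) = refl
  rearrange : ∀ x y z u → (x ∧ y) ∧ (z ∧ u) ≡ z ∧ (x ∧ (y ∧ u))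
  rearrange x y false u = ∧-zeroʳ (x ∧ y)
  rearrange x y true  u = ∧-assoc x y u

count-allVecs : ∀ k B (p : Vec ℕ (suc k) → Bool) →
                count p (allVecs (suc k) B) ≡ sumUpTo (λ a → count (λ w → p (a ∷ w)) (allVecs k B)) (suc B)
count-allVecs k B p = trans (count-concatMap (λ a → a) (suc B))
                            (sumUpTo-cong (suc B) (λ a _ → count-map p (a ∷_) (allVecs k B)))
  where
  rows : ℕ → List (Vec ℕ (suc k))
  rows a = map (a ∷_) (allVecs k B)
  count-concatMap : ∀ h n → count p (concatMap rows (applyUpTo h n)) ≡ sumUpTo (λ a → count p (rows (h a))) n
  count-concatMap h zero    = refl
  count-concatMap h (suc n) =
    trans (count-++ p (rows (h 0)) _) (cong (λ z → _ + z) (count-concatMap (λ a → h (suc a)) n))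

count-∷-partitionOf : ∀ k B m a → a ≤ B →
  count (λ w → partitionOfᵇ m (a ∷ w)) (allVecs k B) ≡ (if a ≤ᵇ m then boundedPartitions k a (m ∸ a) else 0)
count-partitionᵇ : ∀ k B c m → c ≤ B → count (partitionᵇ c m) (allVecs k B) ≡ boundedPartitions k c m

count-∷-partitionOf k B m a a≤B = begin
  count (λ w → partitionOfᵇ m (a ∷ w)) (allVecs k B)
    ≡⟨ count-cong (allVecs k B) (partitionOfᵇ-∷ a m) ⟩
  count (λ w → (a ≤ᵇ m) ∧ partitionᵇ a (m ∸ a) w) (allVecs k B)
    ≡⟨ count-∧ (a ≤ᵇ m) _ (allVecs k B) ⟩
  (if a ≤ᵇ m then count (partitionᵇ a (m ∸ a)) (allVecs k B) else 0)
    ≡⟨ cong (if a ≤ᵇ m then_else 0) (count-partitionᵇ k B a (m ∸ a) a≤B) ⟩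
  (if a ≤ᵇ m then boundedPartitions k a (m ∸ a) else 0)
    ∎
  where open ≡-Reasoning

count-partitionᵇ zero    B c zero    c≤B = refl
count-partitionᵇ zero    B c (suc m) c≤B = refl
count-partitionᵇ (suc k) B c m       c≤B = begin
  count (partitionᵇ c m) (allVecs (suc k) B)
    ≡⟨ count-allVecs k B (partitionᵇ c m) ⟩
  sumUpTo (λ a → count (λ w → (a ≤ᵇ c) ∧ partitionOfᵇ m (a ∷ w)) (allVecs k B)) (suc B)
    ≡⟨ sumUpTo-cong (suc B) (λ a _ → count-∧ (a ≤ᵇ c) (λ w → partitionOfᵇ m (a ∷ w)) (allVecs k B)) ⟩
  sumUpTo (λ a → if a ≤ᵇ c then count (λ w → partitionOfᵇ m (a ∷ w)) (allVecs k B) else 0) (suc B)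
    ≡⟨ sumUpTo-guard (λ a → count (λ w → partitionOfᵇ m (a ∷ w)) (allVecs k B)) c (suc B) (s≤s c≤B) ⟩
  sumUpTo (λ a → count (λ w → partitionOfᵇ m (a ∷ w)) (allVecs k B)) (suc c)
    ≡⟨ sumUpTo-cong (suc c) (λ a a<1+c → count-∷-partitionOf k B m a (ℕP.≤-trans (ℕP.≤-pred a<1+c) c≤B)) ⟩
  boundedPartitions (suc k) c m
    ∎
  where open ≡-Reasoning

pLe-boundedPartitions : ∀ k m → pLe k m ≡ boundedPartitions k m m
pLe-boundedPartitions zero    zero    = refl
pLe-boundedPartitions zero    (suc m) = refl
pLe-boundedPartitions (suc k) m       =
  trans (count-allVecs k m (partitionOfᵇ m))
        (sumUpTo-cong (suc m) (λ a a<1+m → count-∷-partitionOf k m m a (ℕP.≤-pred a<1+m)))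

boundedPartitions-zero-irrelevant : ∀ c c' m → boundedPartitions zero c m ≡ boundedPartitions zero c' m
boundedPartitions-zero-irrelevant c c' zero    = refl
boundedPartitions-zero-irrelevant c c' (suc m) = refl

boundedPartitions-bound-irrelevant : ∀ k {c} m → m ≤ c → boundedPartitions k c m ≡ boundedPartitions k m m
boundedPartitions-bound-irrelevant zero    {c} m m≤c = boundedPartitions-zero-irrelevant c m m
boundedPartitions-bound-irrelevant (suc k) {c} m m≤c =
  sumUpTo-truncate (suc m) (suc c) (s≤s m≤c)
    (λ a m<a → cong (if_then boundedPartitions k a (m ∸ a) else 0) (≤ᵇ-false m<a))

if-+ : ∀ b m n → (if b then m + n else 0) ≡ (if b then m else 0) + (if b then n else 0)
if-+ true  m n = refl
if-+ false m n = refl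

if-nested-∸ : ∀ x y m (G : ℕ → ℕ) →
  (if x ≤ᵇ m then (if y ≤ᵇ m ∸ x then G ((m ∸ x) ∸ y) else 0) else 0)
  ≡ (if x + y ≤ᵇ m then G (m ∸ (x + y)) else 0)
if-nested-∸ zero    y m       G = refl
if-nested-∸ (suc x) y zero    G = refl
if-nested-∸ (suc x) y (suc m) G = begin
  (if suc x ≤ᵇ suc m then (if y ≤ᵇ m ∸ x then G ((m ∸ x) ∸ y) else 0) else 0)
    ≡⟨ cong (if_then (if y ≤ᵇ m ∸ x then G ((m ∸ x) ∸ y) else 0) else 0) (suc-≤ᵇ-suc x m) ⟩
  (if x ≤ᵇ m then (if y ≤ᵇ m ∸ x then G ((m ∸ x) ∸ y) else 0) else 0)
    ≡⟨ if-nested-∸ x y m G ⟩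
  (if x + y ≤ᵇ m then G (m ∸ (x + y)) else 0)
    ≡⟨ cong (if_then G (m ∸ (x + y)) else 0) (suc-≤ᵇ-suc (x + y) m) ⟨
  (if suc x + y ≤ᵇ suc m then G (m ∸ (x + y)) else 0)
    ∎
  where open ≡-Reasoning

if-nested-regroup : ∀ {x y x′ y′} m (G : ℕ → ℕ) → x + y ≡ x′ + y′ →
  (if x ≤ᵇ m then (if y ≤ᵇ m ∸ x then G ((m ∸ x) ∸ y) else 0) else 0)
  ≡ (if x′ ≤ᵇ m then (if y′ ≤ᵇ m ∸ x′ then G ((m ∸ x′) ∸ y′) else 0) else 0)
if-nested-regroup {x} {y} {x′} {y′} m G x+y≡x′+y′ =
  trans (if-nested-∸ x y m G)
        (trans (cong (λ s → if s ≤ᵇ m then G (m ∸ s) else 0) x+y≡x′+y′) (sym (if-nested-∸ x′ y′ m G)))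

-- A partition into at most k+1 parts has at most k parts, or exactly k+1 parts; in the latter case removing 1 from
-- each part leaves a partition of m - (k+1) into at most k+1 parts, and lowers the bound c+1 on the parts to c.
boundedPartitions-suc : ∀ k c m →
  boundedPartitions (suc k) (suc c) m
  ≡ boundedPartitions k (suc c) m + (if suc k ≤ᵇ m then boundedPartitions (suc k) c (m ∸ suc k) else 0)
boundedPartitions-suc zero    c zero    = cong suc (sumUpTo-zero c (λ _ → refl))
boundedPartitions-suc zero    c (suc m) = sumUpTo-cong (suc c) (λ a _ →
  cong₂ (λ b n → if b then n else 0) (suc-≤ᵇ-suc a m) (boundedPartitions-zero-irrelevant (suc a) a (m ∸ a)))
boundedPartitions-suc (suc k) c m = begin
  boundedPartitions (suc k) 0 m + sumUpTo (λ a → if suc a ≤ᵇ m then P′ (suc a) (m ∸ suc a) else 0) (suc c)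
    ≡⟨ cong₂ _+_ (ℕP.+-identityʳ (P k 0 m)) (sumUpTo-cong (suc c) (λ a _ → split a)) ⟩
  P k 0 m + sumUpTo (λ a → U a + V a) (suc c)
    ≡⟨ cong (λ z → P k 0 m + z) (sumUpTo-+ U V (suc c)) ⟩
  P k 0 m + (sumUpTo U (suc c) + sumUpTo V (suc c))
    ≡⟨ ℕP.+-assoc (P k 0 m) _ _ ⟨
  P (suc k) (suc c) m + sumUpTo V (suc c)
    ≡⟨ cong (λ z → P (suc k) (suc c) m + z) (sumUpTo-cong (suc c) (λ a _ → regroup a)) ⟩
  P (suc k) (suc c) m + sumUpTo (λ a → if suc (suc k) ≤ᵇ m then W a else 0) (suc c)
    ≡⟨ cong (λ z → P (suc k) (suc c) m + z) (sumUpTo-if (suc (suc k) ≤ᵇ m) W (suc c)) ⟩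
  P (suc k) (suc c) m + (if suc (suc k) ≤ᵇ m then P (suc (suc k)) c (m ∸ suc (suc k)) else 0)
    ∎
  where
  open ≡-Reasoning
  P : ℕ → ℕ → ℕ → ℕ
  P = boundedPartitions
  P′ : ℕ → ℕ → ℕ
  P′ = boundedPartitions (suc k)
  U V W : ℕ → ℕ
  U a = if suc a ≤ᵇ m then P k (suc a) (m ∸ suc a) else 0
  V a = if suc a ≤ᵇ m then (if suc k ≤ᵇ m ∸ suc a then P′ a ((m ∸ suc a) ∸ suc k) else 0) else 0
  W a = if a ≤ᵇ m ∸ suc (suc k) then P′ a ((m ∸ suc (suc k)) ∸ a) else 0
  regroup : ∀ a → V a ≡ (if suc (suc k) ≤ᵇ m then W a else 0)
  regroup a = if-nested-regroup {suc a} {suc k} {suc (suc k)} {a} m (P′ a) (cong suc (ℕP.+-comm a (suc k)))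
  split : ∀ a → (if suc a ≤ᵇ m then P′ (suc a) (m ∸ suc a) else 0) ≡ U a + V a
  split a = trans (cong (if suc a ≤ᵇ m then_else 0) (boundedPartitions-suc k a (m ∸ suc a))) (if-+ (suc a ≤ᵇ m) _ _)

partitionsAtMost-suc : ∀ k m →
  boundedPartitions (suc k) m m
  ≡ boundedPartitions k m m + (if suc k ≤ᵇ m then boundedPartitions (suc k) (m ∸ suc k) (m ∸ suc k) else 0)
partitionsAtMost-suc k zero    = refl
partitionsAtMost-suc k (suc m) =
  trans (boundedPartitions-suc k m (suc m))
        (cong (λ n → boundedPartitions k (suc m) (suc m) + (if suc k ≤ᵇ suc m then n else 0))
              (boundedPartitions-bound-irrelevant (suc k) (m ∸ k) (ℕP.m∸n≤m m k)))

Δ-injective : ∀ {i} x y → 0 < i → Δ i x ≗ Δ i y → x ≗ y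
Δ-injective {i} x y 0<i Δx≗Δy m =
  ℤP.i-j≡0⇒i≡j (x m) (y m)
    (trans (sym (ℤP.+-identityʳ _)) (ℤ∣.0∣⇒≡0 (divides (Δ-cancel (λ t → x t -ℤ y t) 0<i Δ[x-y]≈0 m))))
  where
  open Modulo 0
  Δ[x-y]≈0 : ∀ m → Δ i (λ t → x t -ℤ y t) m ≈ 0ℤ
  Δ[x-y]≈0 m = ≡⇒≈ (trans (Δ-sub i x y m) (trans (cong (_-ℤ Δ i y m) (Δx≗Δy m)) (ℤP.+-inverseʳ (Δ i y m))))

shift-if : ∀ i x m → shift i x m ≡ (if i ≤ᵇ m then x (m ∸ i) else 0ℤ)
shift-if zero    x m       = refl
shift-if (suc i) x zero    = refl
shift-if (suc i) x (suc m) = trans (shift-if i x m) (cong (if_then x (m ∸ i) else 0ℤ) (sym (suc-≤ᵇ-suc i m)))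

partitionsAtMost : ℕ → Series
partitionsAtMost k m = + boundedPartitions k m m

Δ-partitionsAtMost : ∀ k → Δ (suc k) (partitionsAtMost (suc k)) ≗ partitionsAtMost k
Δ-partitionsAtMost k m = begin
  partitionsAtMost (suc k) m -ℤ shift (suc k) (partitionsAtMost (suc k)) m
    ≡⟨ cong₂ _-ℤ_ (cong +_ (partitionsAtMost-suc k m)) (shift-if (suc k) (partitionsAtMost (suc k)) m) ⟩
  + (boundedPartitions k m m + R) -ℤ (if suc k ≤ᵇ m then partitionsAtMost (suc k) (m ∸ suc k) else 0ℤ)
    ≡⟨ cong (λ r → + (boundedPartitions k m m + R) -ℤ r) (toℤ-if (suc k ≤ᵇ m) _) ⟨
  + (boundedPartitions k m m + R) -ℤ + R
    ≡⟨ cong (_-ℤ + R) (ℤP.pos-+ (boundedPartitions k m m) R) ⟩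
  (partitionsAtMost k m +ℤ + R) -ℤ + R
    ≡⟨ cancel (partitionsAtMost k m) (+ R) ⟩
  partitionsAtMost k m
    ∎
  where
  open ≡-Reasoning
  R : ℕ
  R = if suc k ≤ᵇ m then boundedPartitions (suc k) (m ∸ suc k) (m ∸ suc k) else 0
  cancel : ∀ a b → (a +ℤ b) -ℤ b ≡ a
  cancel = solve-∀
  toℤ-if : ∀ b n → + (if b then n else 0) ≡ (if b then + n else 0ℤ)
  toℤ-if true  n = refl
  toℤ-if false n = refl

pLe-partitionSeries : ∀ k m → + pLe k m ≡ partitionSeries k m
pLe-partitionSeries k m = trans (cong +_ (pLe-boundedPartitions k m)) (partitionsAtMost-partitionSeries k m)
  where
  partitionsAtMost-partitionSeries : ∀ k → partitionsAtMost k ≗ partitionSeries k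
  partitionsAtMost-partitionSeries zero    zero    = refl
  partitionsAtMost-partitionSeries zero    (suc m) = refl
  partitionsAtMost-partitionSeries (suc k) =
    Δ-injective _ _ (s≤s z≤n) (λ m → trans (Δ-partitionsAtMost k m)
                                    (trans (partitionsAtMost-partitionSeries k m) (sym (Δ-partitionSeries k m))))

-- Periods of p_{≤k} and Gaussian coefficients

qPoch-Δ-partitionSeries : ∀ k i → qPoch k (Δ i (partitionSeries k)) ≗ Δ i one
qPoch-Δ-partitionSeries k i m =
  trans (sym (qPoch-Δ k i (partitionSeries k) m)) (Δ-cong i (qPoch-partitionSeries k) m)

period⇒Δ-partitionSeries-vanishes : ∀ N k π → IsPeriod N k π →
                                    ∀ m → π ≤ m → Modulo._≈_ N (Δ π (partitionSeries k) m) 0ℤ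
period⇒Δ-partitionSeries-vanishes N k π (_ , period) m π≤m with offset π m
... | below m<π    = contradiction π≤m (ℕP.<⇒≱ m<π)
... | above t refl = begin
  p≤k (π + t) -ℤ shift π p≤k (π + t) ≡⟨ cong₂ _-ℤ_ (cong p≤k (ℕP.+-comm π t)) (shift-+ π p≤k t) ⟩
  p≤k (t + π) -ℤ p≤k t               ≈⟨ -‿cong₂ periodic (≡⇒≈ refl) ⟩
  p≤k t -ℤ p≤k t                     ≡⟨ ℤP.+-inverseʳ (p≤k t) ⟩
  0ℤ                                 ∎
  where
  open Modulo N
  open ≈-Reasoning
  p≤k : Series
  p≤k = partitionSeries k
  periodic : p≤k (t + π) ≈ p≤k t
  periodic = subst₂ _≈_ (pLe-partitionSeries k (t + π)) (pLe-partitionSeries k t) (≡[mod]⇒≈ (period t))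

corollary2p8 : (N k : ℕ) → 1 ≤ k → (π : ℕ) → IsMinPeriod N k π → (n : ℕ) → π < n →
    ((α : ℕ) → α < π → π < α + (suc k C 2) → coeffGauss n k α ≡[mod N ] (+ 0))
    × ((i j : ℕ) → i + j + (suc k C 2) ≡ π →
    coeffGauss n k i ≡[mod N ] ((-1ℤ ^ suc k) * coeffGauss n k j))
corollary2p8 N k 1≤k π (period , _) n π<n = top-vanish , palindromic
  where
  open Modulo N
  h : Series
  h = Δ π (partitionSeries k)
  open QuotientOfOneMinusQ k π h (period⇒Δ-partitionSeries-vanishes N k π period)
                                 (λ m → ≡⇒≈ (qPoch-Δ-partitionSeries k π m))

  coeffGauss≡h : ∀ {α} → α < π → coeffGauss n k α ≡ h α
  coeffGauss≡h α<π =
    trans (coeffGauss-partitionSeries n k (ℕP.<⇒≤ (ℕP.<-trans α<π π<n))) (sym (Δ-below π (partitionSeries k) α<π))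

  top-vanish : (α : ℕ) → α < π → π < α + (suc k C 2) → coeffGauss n k α ≡[mod N ] (+ 0)
  top-vanish α α<π π<α+C = ≈⇒≡[mod] (≈-trans (≡⇒≈ (coeffGauss≡h α<π))
    (top-coefficients-vanish α (subst (λ d → π < α + d) ([1+k]C2≡triangle k) π<α+C)))

  palindromic : (i j : ℕ) → i + j + (suc k C 2) ≡ π → coeffGauss n k i ≡[mod N ] ((-1ℤ ^ suc k) * coeffGauss n k j)
  palindromic i j i+j+C≡π = ≈⇒≡[mod] (≈-trans (≡⇒≈ (coeffGauss≡h i<π))
    (≈-trans (coefficients-palindromic i j i+j+t≡π) (≡⇒≈ (cong ((-1ℤ ^ suc k) *_) (sym (coeffGauss≡h j<π))))))
    where
    i+j+t≡π : i + j + triangle k ≡ π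
    i+j+t≡π = trans (cong (λ d → i + j + d) (sym ([1+k]C2≡triangle k))) i+j+C≡π
    i+j<π : i + j < π
    i+j<π = subst (i + j <_) i+j+t≡π (ℕP.m<m+n (i + j) (0<triangle 1≤k))
    i<π : i < π
    i<π = ℕP.≤-<-trans (ℕP.m≤m+n i j) i+j<π
    j<π : j < π
    j<π = ℕP.≤-<-trans (ℕP.m≤n+m j i) i+j<π
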